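{- Given an order-$k$ collapsible nondeterministic pushdown tree automaton $\mathcal{N}$ and $p\in AP$, one can build an order-$k$ collapsible nondeterministic pushdown tree automaton $\mathcal{N}_{\Downarrow p}$ such that for every pointed tree $(T,u)$ and every initial $k$-stack $w_\iota\in\mathrm{Stacks}_k$, $(T,u)\in L(\mathcal{N}_{\Downarrow p},w_\iota)$ if and only if there exists a $p$-labelling $f$ of $T$ such that $(T\otimes f,u)\in L(\mathcal{N},w_\iota)$.
   Context: Trees: a $D$-tree is a set $\tau\subseteq D^+$ with a common root letter, closed under nonempty prefixes, every node having a child; complete if every node has every child; an $(AP,D)$-tree is $T=(\tau,\ell)$, $\ell:\tau\to2^{AP}$; automata read complete trees; a pointed tree is $(T,u)$ with $u$ a node. A $p$-labelling is $f:\tau\to\{0,1\}$; $T\otimes f$ replaces the labelling of $p$ by $f$. Higher-order stacks: for a finite alphabet $\Gamma$ and $\bot\notin\Gamma$, order-1 stacks with links are words $\bot a_1\dots a_\ell$ with each $a_i\in\Gamma$ or $a_i=(a,j,h)\in\Gamma\times\{2,\dots,k\}\times\mathbb{N}$; order-$j$ stacks ($j>1$) are nonempty sequences of order-$(j-1)$ stacks; $\mathrm{Stacks}_k$ is the set of order-$k$ stacks. $\mathrm{op}_k(\Gamma)$ is the set of operations: $\mathrm{pop}_i$ (remove the topmost order-$(i-1)$ stack of the topmost order-$i$ stack, if the latter has length $\ge2$), $\mathrm{push}_i$ ($2\le i\le k$; duplicate it), $\mathrm{push}_1^a$ (push $a\in\Gamma$ on the topmost order-1 stack), $\mathrm{push}_1^{a,\ell}$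 (push $(a,\ell,h)$ with $h=|\mathrm{top}_\ell(w)|-1$, where $\mathrm{top}_\ell$ is the topmost order-$(\ell-1)$ stack... more precisely $|\mathrm{top}_\ell(w)|$ is the length of the topmost order-$\ell$ stack), and $\mathrm{collapse}$ (if the topmost symbol is $(a,\ell,h)$, truncate the topmost order-$\ell$ stack to its first $h$ elements). An order-$k$ collapsible alternating pushdown tree automaton (CAPTA) on $(AP,D)$-trees is $(\Gamma,Q,\delta,q_\iota,C)$ with $\Gamma$ finite (with bottom $\bot$), $Q$ finite, $q_\iota\in Q$, $\delta:Q\times2^{AP}\times\Gamma\to B^+(D\times Q\times\mathrm{op}_k(\Gamma))$ (positive Boolean formulas with constants $\mathit{true},\mathit{false}$), $C:Q\to\mathbb{N}$. Acceptance of $(T,u)$ from initial stack $w_\iota$: parity game with positions $(v,q,w,\beta)$, start $(u,q_\iota,w_\iota,\delta(q_\iota,\ell(u),\gamma))$ where $\gamma$ is the topmost symbol of $w_\iota$; Eve resolves disjunctions, Adam conjunctions; atom $[x,q',op]$ at node $v$ with stack $w$ leads to $(vx,q',op(w),\delta(q',\ell(vx),\gamma'))$ with $\gamma'$ the topmost symbol of $op(w)$; $\mathit{true}$ wins for Eve, $\mathit{false}$ for Adam; Eve wins infinite plays whose maximal colour $C(q)$ occurring infinitely often is even; $L(\mathcal{A},w_\iota)$ is the set of pointed trees where Eve wins. A collapsible nondeterministic pushdown tree automaton (CNPTA) is a CAPTA in which every $\delta(q,a,\gamma)$ is in disjunctive normal form and for every direction $x$ each disjunct contains exactly one atom in $\{x\}\times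 Q\times\mathrm{op}_k(\Gamma)$. -}

module Defs where

open import Data.Nat using (ℕ; zero; suc; _≤_; _<_; _∸_; _≡ᵇ_; _≤ᵇ_)
open import Data.Nat.Divisibility using (_∣_)
open import Data.Fin using (Fin)
open import Data.Fin.Properties using () renaming (_≟_ to _≟ᶠ_)
open import Data.Bool using (Bool; true; false; if_then_else_; _∧_)
open import Data.Unit using (⊤; tt)
open import Data.Sum using (_⊎_; inj₁; inj₂)
open import Data.Product using (Σ; _×_; _,_; proj₁; proj₂; ∃)
open import Data.Maybe using (Maybe; just; nothing)
open import Data.List using (List; []; _∷_; length; drop; _++_; [_])
open import Data.List.NonEmpty using (List⁺; _∷_; toList; fromList) renaming (length to length⁺)
open import Data.List.Relation.Unary.All using (All)
open import Relation.Nullary using (does)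
open import Relation.Binary.PropositionalEquality using (_≡_)

-- Atomic propositions AP = Fin m, directions D = Fin (suc d)
-- (finite, nonempty).  Automata read complete trees, whose node set is
-- r·D^* for the root letter r; we identify the node r x₁ … xₙ with the
-- list xₙ ∷ … ∷ x₁ ∷ [] (most recent direction first), so that the child
-- v·x of v is  x ∷ v.

Node : ℕ → Set
Node d = List (Fin (suc d))

Tree : ℕ → ℕ → Set
Tree m d = Node d → (Fin m → Bool)

_⊗[_]_ : ∀ {m d} → Tree m d → Fin m → (Node d → Bool) → Tree m d
(T ⊗[ p ] f) v a = if does (a ≟ᶠ p) then f v else T v a

record Link (k : ℕ) : Set where
  constructor link
  field
    ord  : ℕ
    2≤o  : 2 ≤ ord
    o≤k  : ord ≤ k
    hgt  : ℕ

Sym : ℕ → ℕ → Set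
Sym g k = Fin g ⊎ (Fin g × Link k)

letter : ∀ {g k} → Sym g k → Fin g
letter (inj₁ a) = a
letter (inj₂ (a , _)) = a

-- An order-1 stack ⊥ a₁ … aₗ is
-- represented by the list aₗ ∷ … ∷ a₁ (the bottom ⊥ is implicit, topmost
-- symbol first); an order-(n+1) stack is a nonempty list of order-n
-- stacks, topmost first.  Stk g k 0 is a dummy.
Stk : ℕ → ℕ → ℕ → Set
Stk g k zero = ⊤
Stk g k (suc zero) = List (Sym g k)
Stk g k (suc (suc n)) = List⁺ (Stk g k (suc n))

Stacks : ℕ → ℕ → Set
Stacks g k = Stk g k k

module StackOps {g k : ℕ} where

  private
    S = Sym g k
    mapM : {A B : Set} → (A → B) → Maybe A → Maybe B
    mapM f (just x) = just (f x)
    mapM f nothing = nothing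

  -- topmost symbol (nothing = ⊥)
  topSym : (n : ℕ) → Stk g k n → Maybe S
  topSym zero _ = nothing
  topSym (suc zero) [] = nothing
  topSym (suc zero) (a ∷ _) = just a
  topSym (suc (suc n)) (x ∷ _) = topSym (suc n) x

  -- |top_i(w)| : length of the topmost order-i stack (order-1 length counts ⊥)
  lenTop : (i n : ℕ) → Stk g k n → ℕ
  lenTop i zero _ = 0
  lenTop i (suc zero) s = suc (length s)
  lenTop i (suc (suc n)) (x ∷ xs) =
    if i ≡ᵇ suc (suc n) then suc (length xs) else lenTop i (suc n) x

  pop : (i n : ℕ) → Stk g k n → Maybe (Stk g k n)
  pop i zero _ = nothing
  pop i (suc zero) [] = nothing
  pop i (suc zero) (a ∷ s) = if i ≡ᵇ 1 then just s else nothing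
  pop i (suc (suc n)) (x ∷ []) =
    if i ≡ᵇ suc (suc n) then nothing else mapM (λ y → y ∷ []) (pop i (suc n) x)
  pop i (suc (suc n)) (x ∷ (y ∷ ys)) =
    if i ≡ᵇ suc (suc n) then just (y ∷ ys)
    else mapM (λ z → z ∷ (y ∷ ys)) (pop i (suc n) x)

  push : (i n : ℕ) → Stk g k n → Maybe (Stk g k n)
  push i zero _ = nothing
  push i (suc zero) _ = nothing
  push i (suc (suc n)) (x ∷ xs) =
    if i ≡ᵇ suc (suc n) then just (x ∷ (x ∷ xs))
    else mapM (λ z → z ∷ xs) (push i (suc n) x)

  push1 : S → (n : ℕ) → Stk g k n → Maybe (Stk g k n)
  push1 a zero _ = nothing
  push1 a (suc zero) s = just (a ∷ s)
  push1 a (suc (suc n)) (x ∷ xs) = mapM (λ z → z ∷ xs) (push1 a (suc n) x)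

  -- truncate the topmost order-ℓ stack to its first (bottom-most) h
  -- elements; undefined unless 1 ≤ h ≤ its length (order-ℓ stacks are
  -- nonempty)
  trunc : (ℓ h n : ℕ) → Stk g k n → Maybe (Stk g k n)
  trunc ℓ h zero _ = nothing
  trunc ℓ h (suc zero) _ = nothing
  trunc ℓ h (suc (suc n)) (x ∷ xs) =
    if ℓ ≡ᵇ suc (suc n)
    then (if h ≤ᵇ suc (length xs)
          then fromList (drop (suc (length xs) ∸ h) (x ∷ xs))
          else nothing)
    else mapM (λ z → z ∷ xs) (trunc ℓ h (suc n) x)

  collapseAt : (n : ℕ) → Stk g k n → Maybe (Stk g k n)
  collapseAt n s with topSym n s
  ... | just (inj₂ (a , link ℓ _ _ h)) = trunc ℓ h n s
  ... | _ = nothing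

data Op (g k : ℕ) : Set where
  popOp      : (i : ℕ) → 1 ≤ i → i ≤ k → Op g k
  pushOp     : (i : ℕ) → 2 ≤ i → i ≤ k → Op g k
  push1Op    : Fin g → Op g k
  push1LinkOp : Fin g → (ℓ : ℕ) → 2 ≤ ℓ → ℓ ≤ k → Op g k
  collapseOp : Op g k

applyOp : ∀ {g k} → Op g k → Stacks g k → Maybe (Stacks g k)
applyOp {g} {k} (popOp i _ _) w = StackOps.pop {g} {k} i k w
applyOp {g} {k} (pushOp i _ _) w = StackOps.push {g} {k} i k w
applyOp {g} {k} (push1Op a) w = StackOps.push1 {g} {k} (inj₁ a) k w
applyOp {g} {k} (push1LinkOp a ℓ p q) w =
  StackOps.push1 {g} {k}
    (inj₂ (a , link ℓ p q (StackOps.lenTop {g} {k} ℓ k w ∸ 1))) k w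
applyOp {g} {k} collapseOp w = StackOps.collapseAt {g} {k} k w

topLetter : ∀ {g k} → Stacks g k → Maybe (Fin g)
topLetter {g} {k} w with StackOps.topSym {g} {k} k w
... | just s = just (letter s)
... | nothing = nothing

data PBF (X : Set) : Set where
  ttᶠ  : PBF X
  ffᶠ  : PBF X
  atom : X → PBF X
  _∧ᶠ_ : PBF X → PBF X → PBF X
  _∨ᶠ_ : PBF X → PBF X → PBF X

Atom : ℕ → ℕ → ℕ → ℕ → Set
Atom d nQ g k = Fin (suc d) × Fin nQ × Op g k

record CAPTA (m d g k : ℕ) : Set where
  field
    nQ : ℕ
    δ  : Fin nQ → (Fin m → Bool) → Maybe (Fin g) → PBF (Atom d nQ g k)
    qι : Fin nQ
    C  : Fin nQ → ℕ

disjuncts : ∀ {X} → PBF X → List (PBF X)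
disjuncts (φ ∨ᶠ ψ) = disjuncts φ ++ disjuncts ψ
disjuncts φ = [ φ ]

conjuncts : ∀ {X} → PBF X → List (PBF X)
conjuncts (φ ∧ᶠ ψ) = conjuncts φ ++ conjuncts ψ
conjuncts φ = [ φ ]

data IsAtom {X : Set} : PBF X → Set where
  isAtom : (a : X) → IsAtom (atom a)

countDir : ∀ {d nQ g k} → Fin (suc d) → List (PBF (Atom d nQ g k)) → ℕ
countDir x [] = 0
countDir x (atom (y , _) ∷ φs) =
  if does (y ≟ᶠ x) then suc (countDir x φs) else countDir x φs
countDir x (_ ∷ φs) = countDir x φs

-- φ is a DNF (possibly the empty disjunction false) in which each
-- disjunct has exactly one atom per direction
NondetFormula : ∀ {d nQ g k} → PBF (Atom d nQ g k) → Set
NondetFormula {d} φ =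
  (φ ≡ ffᶠ) ⊎
  All (λ ψ → All IsAtom (conjuncts ψ) ×
             ((x : Fin (suc d)) → countDir x (conjuncts ψ) ≡ 1))
      (disjuncts φ)

record CNPTA (m d g k : ℕ) : Set where
  field
    aut    : CAPTA m d g k
    nondet : ∀ q a γ → NondetFormula (CAPTA.δ aut q a γ)

module Game {m d g k : ℕ} (A : CAPTA m d g k) (T : Tree m d) where
  open CAPTA A

  record Pos : Set where
    constructor pos
    field
      node  : Node d
      state : Fin nQ
      stack : Stacks g k
      form  : PBF (Atom d nQ g k)
  open Pos public

  -- positions where the play stops: true, false, or an atom whose stack
  -- operation is undefined (treated like false)
  stuck : Pos → Bool
  stuck (pos v q w ttᶠ) = true
  stuck (pos v q w ffᶠ) = true
  stuck (pos v q w (atom (x , q' , op))) with applyOp op w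
  ... | just _ = false
  ... | nothing = true
  stuck (pos v q w (_ ∧ᶠ _)) = false
  stuck (pos v q w (_ ∨ᶠ _)) = false

  -- a strategy sees the whole history (current position first) and,
  -- at a position of its owner, chooses left (true) or right (false)
  Strategy : Set
  Strategy = List Pos → Bool

  next : Strategy → Strategy → List Pos → Pos → Pos
  next σ τ h (pos v q w (φ ∨ᶠ ψ)) =
    if σ (pos v q w (φ ∨ᶠ ψ) ∷ h) then pos v q w φ else pos v q w ψ
  next σ τ h (pos v q w (φ ∧ᶠ ψ)) =
    if τ (pos v q w (φ ∧ᶠ ψ) ∷ h) then pos v q w φ else pos v q w ψ
  next σ τ h (pos v q w (atom (x , q' , op))) with applyOp op w
  ... | just w' = pos (x ∷ v) q' w' (δ q' (T (x ∷ v)) (topLetter w'))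
  ... | nothing = pos v q w (atom (x , q' , op))
  next σ τ h (pos v q w ttᶠ) = pos v q w ttᶠ
  next σ τ h (pos v q w ffᶠ) = pos v q w ffᶠ

  run : Strategy → Strategy → Pos → ℕ → List Pos × Pos
  run σ τ p₀ zero = [] , p₀
  run σ τ p₀ (suc n) with run σ τ p₀ n
  ... | h , p = (p ∷ h) , next σ τ h p

  play : Strategy → Strategy → Pos → ℕ → Pos
  play σ τ p₀ n = proj₂ (run σ τ p₀ n)

  ParityWin : (ℕ → ℕ) → Set
  ParityWin c = Σ ℕ λ e → (2 ∣ e)
    × ((n : ℕ) → Σ ℕ λ n' → n ≤ n' × c n' ≡ e)
    × (Σ ℕ λ N → (n : ℕ) → N ≤ n → c n ≤ e)

  EveWinsPlay : (ℕ → Pos) → Set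
  EveWinsPlay π =
    (Σ ℕ λ n → form (π n) ≡ ttᶠ) ⊎
    (((n : ℕ) → stuck (π n) ≡ false) × ParityWin (λ n → C (state (π n))))

  initial : Stacks g k → Node d → Pos
  initial wι u = pos u qι wι (δ qι (T u) (topLetter wι))

  EveWins : Stacks g k → Node d → Set
  EveWins wι u = Σ Strategy λ σ → (τ : Strategy) → EveWinsPlay (play σ τ (initial wι u))

Accepts : ∀ {m d g k} → CAPTA m d g k → Stacks g k → Tree m d → Node d → Set
Accepts A wι T u = Game.EveWins A T wι u

module Submission where

-- N⇓p runs N but, on entering a node, lets Eve guess the value of p
-- there: its transition formula is δ(q,a[p≔1],γ) ∨ δ(q,a[p≔0],γ), with a
-- false disjunct dropped so that N⇓p stays nondeterministic.  For a
-- labelling f, the game of N on T ⊗ f and the game of N⇓p on T are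
-- coupled (module Simulation): histories are translated by inserting the
-- guess positions, N⇓p's play is a stuttering of N's play (each step of N
-- takes at most two steps of N⇓p), and parity is invariant under
-- stuttering, so Eve wins one play iff she wins the other, provided her
-- guesses select the formulas N reads.
--   * Given f and a winning strategy of N, Eve wins N⇓p by guessing f
--     (module LabellingToStrategy).
--   * Given a winning strategy σ⇓ of N⇓p, nondeterminism implies that the
--     history with which a play enters a node does not depend on Adam: at
--     a conjunction he must take the side containing the next direction
--     (module Descent).  Labelling each node by Eve's guess there gives f,
--     and σ⇓ read through the translation wins N on T ⊗ f
--     (module StrategyToLabelling).

open import Defs
open import Data.Nat using (ℕ; zero; suc; _+_; _≤_; _<_; z≤n; s≤s; _≟_; _≤?_; _≤′_; ≤′-refl; ≤′-step)
open import Data.Nat.Properties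
open import Data.Nat.Divisibility using (_∣_)
open import Data.Fin using (Fin)
open import Data.Fin.Properties using () renaming (_≟_ to _≟ᶠ_)
open import Data.Bool using (Bool; true; false; if_then_else_; _∧_; _∨_; not)
open import Data.Bool.Properties using (∨-zeroʳ)
open import Function using (_∘_)
open import Data.Product using (Σ; _×_; _,_; proj₁; proj₂)
open import Data.Sum using (_⊎_; inj₁; inj₂)
open import Data.Maybe using (Maybe; just; nothing)
open import Data.List using (List; []; _∷_; _++_; length)
open import Data.List.Properties using (≡-dec; length-++; ++-assoc; ++-identityˡ-unique; ∷-injective; ∷-injectiveˡ; ∷-injectiveʳ)
open import Data.List.Relation.Unary.All using (All; []; _∷_)
open import Data.List.Relation.Unary.All.Properties using (++⁺; ++⁻ˡ; ++⁻ʳ)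
open import Data.Empty using (⊥; ⊥-elim)
open import Data.Unit using (⊤)
open import Relation.Nullary using (Dec; yes; no; does)
open import Relation.Binary.Definitions using (tri<; tri≈; tri>)
open import Relation.Binary.PropositionalEquality

true≢false : true ≢ false
true≢false ()

at-most-one : ∀ {a b : Bool} → (a ≡ true → b ≡ false) → b ≡ true → a ≡ false
at-most-one {false} _ _ = refl
at-most-one {true} ex refl = ⊥-elim (true≢false (ex refl))

not-∧-not : ∀ {a b : Bool} → (not a ∧ not b) ≡ true → a ≡ false × b ≡ false
not-∧-not {false} {false} refl = refl , refl

isFF : ∀ {X : Set} → PBF X → Bool
isFF ffᶠ = true
isFF _   = false

isFF-true : ∀ {X : Set} (φ : PBF X) → isFF φ ≡ true → φ ≡ ffᶠ
isFF-true ffᶠ _ = refl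

-- Disjunction that drops a false disjunct; unlike _∨ᶠ_ it keeps the
-- disjunction of two nondeterministic formulas nondeterministic (false
-- must be the whole formula, never a disjunct).
_∨?_ : ∀ {X : Set} → PBF X → PBF X → PBF X
φ ∨? ψ = if isFF φ then ψ else (if isFF ψ then φ else (φ ∨ᶠ ψ))

∨?-both : ∀ {X : Set} (φ ψ : PBF X) → isFF φ ≡ false → isFF ψ ≡ false → φ ∨? ψ ≡ (φ ∨ᶠ ψ)
∨?-both φ ψ eφ eψ rewrite eφ | eψ = refl

OneAtomPerDirection : ∀ {d nQ g k} → PBF (Atom d nQ g k) → Set
OneAtomPerDirection {d} ψ =
  All IsAtom (conjuncts ψ) × ((x : Fin (suc d)) → countDir x (conjuncts ψ) ≡ 1)

nondet-disjuncts : ∀ {d nQ g k} {φ : PBF (Atom d nQ g k)} →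
  NondetFormula φ → isFF φ ≡ false → All OneAtomPerDirection (disjuncts φ)
nondet-disjuncts (inj₁ refl) ()
nondet-disjuncts (inj₂ ds) _ = ds

nondet-∨? : ∀ {d nQ g k} {φ ψ : PBF (Atom d nQ g k)} →
  NondetFormula φ → NondetFormula ψ → NondetFormula (φ ∨? ψ)
nondet-∨? {φ = φ} {ψ} nφ nψ with isFF φ in eφ
... | true = nψ
... | false with isFF ψ in eψ
...   | true = nφ
...   | false = inj₂ (++⁺ (nondet-disjuncts nφ eφ) (nondet-disjuncts nψ eψ))

∨?-forced : ∀ {X : Set} (φ ψ : PBF X) (c : Bool) → (not (isFF φ) ∧ not (isFF ψ)) ≡ false →
  (if c then φ else ψ) ≢ ffᶠ → φ ∨? ψ ≡ (if c then φ else ψ)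
∨?-forced φ ψ c forced selected with isFF φ in eφ
∨?-forced φ ψ false forced selected | true = refl
∨?-forced φ ψ true  forced selected | true = ⊥-elim (selected (isFF-true φ eφ))
∨?-forced φ ψ c     forced selected | false with isFF ψ in eψ
∨?-forced φ ψ true  forced selected | false | true = refl
∨?-forced φ ψ false forced selected | false | true = ⊥-elim (selected (isFF-true ψ eψ))
∨?-forced φ ψ c     () selected     | false | false

select : ∀ {X : Set} → PBF X → PBF X → Bool → Bool
select φ ψ c = if isFF φ then false else (if isFF ψ then true else c)

∨?-select : ∀ {X : Set} (φ ψ : PBF X) (c : Bool) →
  (if not (isFF φ) ∧ not (isFF ψ) then (if c then φ else ψ) else φ ∨? ψ) ≡ (if select φ ψ c then φ else ψ)
∨?-select φ ψ c with isFF φ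
... | true = refl
... | false with isFF ψ
...   | true = refl
...   | false = refl

_[_≔_] : ∀ {m} → (Fin m → Bool) → Fin m → Bool → (Fin m → Bool)
(a [ p ≔ b ]) c = if does (c ≟ᶠ p) then b else a c

_⇓_ : ∀ {m d g k} → CNPTA m d g k → Fin m → CNPTA m d g k
_⇓_ {m} {d} {g} {k} N p = record
  { aut = record { nQ = nQ ; δ = δ⇓ ; qι = qι ; C = C }
  ; nondet = λ q a γ → nondet-∨? (nondet q (a [ p ≔ true ]) γ) (nondet q (a [ p ≔ false ]) γ) }
  where
    open CNPTA N
    open CAPTA aut
    δ⇓ : Fin nQ → (Fin m → Bool) → Maybe (Fin g) → PBF (Atom d nQ g k)
    δ⇓ q a γ = δ q (a [ p ≔ true ]) γ ∨? δ q (a [ p ≔ false ]) γ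

-- v ≼ w : w is a descendant of v (a node lists its directions most
-- recent first, so descendants extend it on the left).
_≼_ : ∀ {A : Set} → List A → List A → Set
_≼_ {A} v w = Σ (List A) λ zs → w ≡ zs ++ v

≼-refl : ∀ {A : Set} (v : List A) → v ≼ v
≼-refl v = [] , refl

≼-trans : ∀ {A : Set} {u v w : List A} → u ≼ v → v ≼ w → u ≼ w
≼-trans {u = u} (zs , refl) (ys , refl) = ys ++ zs , sym (++-assoc ys zs u)

≼-child : ∀ {A : Set} (x : A) (v : List A) → v ≼ (x ∷ v)
≼-child x v = x ∷ [] , refl

no-proper-cycle : ∀ {A : Set} (zs : List A) (x : A) (v : List A) → v ≢ zs ++ x ∷ v
no-proper-cycle zs x v e = <-irrefl (cong length e) longer
  where
    longer : length v < length (zs ++ x ∷ v)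
    longer = subst (length v <_) (sym (length-++ zs))
               (≤-trans (n<1+n (length v)) (m≤n+m (suc (length v)) (length zs)))

child-⋠ : ∀ {A : Set} (x : A) (v : List A) → (x ∷ v) ≼ v → ⊥
child-⋠ x v (zs , e) = no-proper-cycle zs x v e

child-unique : ∀ {A : Set} {x y : A} {v w : List A} → (x ∷ v) ≼ w → (y ∷ v) ≼ w → x ≡ y
child-unique {A} {x} {y} {v} (zs , refl) (ys , e) = aligned zs ys e
  where
    aligned : (zs ys : List A) → zs ++ x ∷ v ≡ ys ++ y ∷ v → x ≡ y
    aligned []       []       e = ∷-injectiveˡ e
    aligned []       (_ ∷ ys) e = ⊥-elim (no-proper-cycle ys y v (∷-injectiveʳ e))
    aligned (_ ∷ zs) []       e = ⊥-elim (no-proper-cycle zs x v (sym (∷-injectiveʳ e)))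
    aligned (_ ∷ zs) (_ ∷ ys) e = aligned zs ys (∷-injectiveʳ e)

module Plays {m d g k : ℕ} (A : CAPTA m d g k) (T : Tree m d) where
  open CAPTA A
  open Game A T

  _≟ₙ_ : (v w : Node d) → Dec (v ≡ w)
  _≟ₙ_ = ≡-dec _≟ᶠ_

  isEntry : Pos → List Pos → Bool
  isEntry P []      = true
  isEntry P (Q ∷ _) = not (does (node P ≟ₙ node Q))

  isEntry-same : ∀ P Q h → node P ≡ node Q → isEntry P (Q ∷ h) ≡ false
  isEntry-same P Q h e with node P ≟ₙ node Q
  ... | yes _ = refl
  ... | no ne = ⊥-elim (ne e)

  isEntry-diff : ∀ P Q h → node P ≢ node Q → isEntry P (Q ∷ h) ≡ true
  isEntry-diff P Q h ne with node P ≟ₙ node Q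
  ... | yes e = ⊥-elim (ne e)
  ... | no _  = refl

  isEntry-false : ∀ P Q h → isEntry P (Q ∷ h) ≡ false → node P ≡ node Q
  isEntry-false P Q h e with node P ≟ₙ node Q
  isEntry-false P Q h () | no _
  ... | yes same = same

  EntersChild : Pos → Pos → Set
  EntersChild P P' = Σ (Fin (suc d)) λ y → Σ (Fin nQ) λ q' → Σ (Stacks g k) λ w' →
    P' ≡ pos (y ∷ node P) q' w' (δ q' (T (y ∷ node P)) (topLetter w'))

  next-shape : ∀ σ τ h P → (node (next σ τ h P) ≡ node P) ⊎ EntersChild P (next σ τ h P)
  next-shape σ τ h (pos v q w ttᶠ) = inj₁ refl
  next-shape σ τ h (pos v q w ffᶠ) = inj₁ refl
  next-shape σ τ h (pos v q w (atom (x , q' , op))) with applyOp op w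
  ... | just w' = inj₂ (x , q' , w' , refl)
  ... | nothing = inj₁ refl
  next-shape σ τ h (pos v q w (φ ∧ᶠ ψ)) with τ (pos v q w (φ ∧ᶠ ψ) ∷ h)
  ... | true  = inj₁ refl
  ... | false = inj₁ refl
  next-shape σ τ h (pos v q w (φ ∨ᶠ ψ)) with σ (pos v q w (φ ∨ᶠ ψ) ∷ h)
  ... | true  = inj₁ refl
  ... | false = inj₁ refl

  next-≼ : ∀ σ τ h P → node P ≼ node (next σ τ h P)
  next-≼ σ τ h P with next-shape σ τ h P
  ... | inj₁ e = [] , e
  ... | inj₂ (y , q' , w' , e) rewrite e = ≼-child y (node P)

  next-∨ : ∀ σ τ h v q w φ ψ →
    next σ τ h (pos v q w (φ ∨ᶠ ψ)) ≡ pos v q w (if σ (pos v q w (φ ∨ᶠ ψ) ∷ h) then φ else ψ)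
  next-∨ σ τ h v q w φ ψ with σ (pos v q w (φ ∨ᶠ ψ) ∷ h)
  ... | true  = refl
  ... | false = refl

  next-∧ : ∀ σ τ h v q w φ ψ →
    next σ τ h (pos v q w (φ ∧ᶠ ψ)) ≡ pos v q w (if τ (pos v q w (φ ∧ᶠ ψ) ∷ h) then φ else ψ)
  next-∧ σ τ h v q w φ ψ with τ (pos v q w (φ ∧ᶠ ψ) ∷ h)
  ... | true  = refl
  ... | false = refl

  next-atom : ∀ σ τ h v q w x q' op w' → applyOp op w ≡ just w' →
    next σ τ h (pos v q w (atom (x , q' , op))) ≡ pos (x ∷ v) q' w' (δ q' (T (x ∷ v)) (topLetter w'))
  next-atom σ τ h v q w x q' op w' e rewrite e = refl

  next-blocked : ∀ σ τ h v q w x q' op → applyOp op w ≡ nothing →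
    next σ τ h (pos v q w (atom (x , q' , op))) ≡ pos v q w (atom (x , q' , op))
  next-blocked σ τ h v q w x q' op e rewrite e = refl

  next-tt : ∀ σ τ h P → form P ≡ ttᶠ → next σ τ h P ≡ P
  next-tt σ τ h (pos v q w .ttᶠ) refl = refl

  next-ff : ∀ σ τ h P → form P ≡ ffᶠ → next σ τ h P ≡ P
  next-ff σ τ h (pos v q w .ffᶠ) refl = refl

  stuck-ff : ∀ P → form P ≡ ffᶠ → stuck P ≡ true
  stuck-ff (pos v q w .ffᶠ) refl = refl

  module Run (σ τ : Strategy) (p₀ : Pos) where
    hist : ℕ → List Pos
    hist n = proj₁ (run σ τ p₀ n)

    pl : ℕ → Pos
    pl = play σ τ p₀

    run-suc : ∀ n → run σ τ p₀ (suc n) ≡ (pl n ∷ hist n , next σ τ (hist n) (pl n))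
    run-suc n with run σ τ p₀ n
    ... | h , P = refl

    run-step : ∀ {n h P} → run σ τ p₀ n ≡ (h , P) → run σ τ p₀ (suc n) ≡ (P ∷ h , next σ τ h P)
    run-step {n} e = trans (run-suc n)
      (cong₂ _,_ (cong₂ _∷_ (cong proj₂ e) (cong proj₁ e)) (cong₂ (next σ τ) (cong proj₁ e) (cong proj₂ e)))

    run-move : ∀ {n h P P'} → run σ τ p₀ n ≡ (h , P) → next σ τ h P ≡ P' → run σ τ p₀ (suc n) ≡ (P ∷ h , P')
    run-move e move = trans (run-step e) (cong (_ ,_) move)

    run-∨ : ∀ {n h v q w φ ψ b} → run σ τ p₀ n ≡ (h , pos v q w (φ ∨ᶠ ψ)) → σ (pos v q w (φ ∨ᶠ ψ) ∷ h) ≡ b →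
      run σ τ p₀ (suc n) ≡ (pos v q w (φ ∨ᶠ ψ) ∷ h , pos v q w (if b then φ else ψ))
    run-∨ {h = h} {v} {q} {w} {φ} {ψ} e choice =
      run-move e (trans (next-∨ σ τ h v q w φ ψ) (cong (λ b → pos v q w (if b then φ else ψ)) choice))

    run-∧ : ∀ {n h v q w φ ψ b} → run σ τ p₀ n ≡ (h , pos v q w (φ ∧ᶠ ψ)) → τ (pos v q w (φ ∧ᶠ ψ) ∷ h) ≡ b →
      run σ τ p₀ (suc n) ≡ (pos v q w (φ ∧ᶠ ψ) ∷ h , pos v q w (if b then φ else ψ))
    run-∧ {h = h} {v} {q} {w} {φ} {ψ} e choice =
      run-move e (trans (next-∧ σ τ h v q w φ ψ) (cong (λ b → pos v q w (if b then φ else ψ)) choice))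

    pl-suc : ∀ n → pl (suc n) ≡ next σ τ (hist n) (pl n)
    pl-suc n = cong proj₂ (run-suc n)

    hist-suc : ∀ n → hist (suc n) ≡ pl n ∷ hist n
    hist-suc n = cong proj₁ (run-suc n)

    descends : ∀ {a b} → a ≤ b → node (pl a) ≼ node (pl b)
    descends {a} a≤b = go (≤⇒≤′ a≤b)
      where
        go : ∀ {b} → a ≤′ b → node (pl a) ≼ node (pl b)
        go ≤′-refl = ≼-refl _
        go (≤′-step {b} le) rewrite pl-suc b = ≼-trans (go le) (next-≼ σ τ (hist b) (pl b))

    halted : ∀ i → (∀ h → next σ τ h (pl i) ≡ pl i) → ∀ {j} → i ≤ j → pl j ≡ pl i
    halted i fix i≤j = go (≤⇒≤′ i≤j)
      where
        go : ∀ {j} → i ≤′ j → pl j ≡ pl i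
        go ≤′-refl = refl
        go (≤′-step {j} le) = trans (pl-suc j) (trans (cong (next σ τ (hist j)) (go le)) (fix _))

    isEntryAt : ℕ → Bool
    isEntryAt n = isEntry (pl n) (hist n)

    isEntryAt-suc : ∀ n → isEntryAt (suc n) ≡ isEntry (pl (suc n)) (pl n ∷ hist n)
    isEntryAt-suc n = cong (isEntry (pl (suc n))) (hist-suc n)

    entry-enters : ∀ n → isEntryAt (suc n) ≡ true → EntersChild (pl n) (pl (suc n))
    entry-enters n e with next-shape σ τ (hist n) (pl n)
    ... | inj₁ same = ⊥-elim (true≢false (trans (sym e) (trans (isEntryAt-suc n)
                          (isEntry-same (pl (suc n)) (pl n) (hist n) (trans (cong node (pl-suc n)) same)))))
    ... | inj₂ (y , q' , w' , eq) = y , q' , w' , trans (pl-suc n) eq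

    entry-descends : ∀ n → isEntryAt (suc n) ≡ true →
      Σ (Fin (suc d)) λ y → node (pl (suc n)) ≡ y ∷ node (pl n)
    entry-descends n e with entry-enters n e
    ... | y , _ , _ , eq = y , cong node eq

    nonentry-stays : ∀ n → isEntryAt (suc n) ≡ false → node (pl (suc n)) ≡ node (pl n)
    nonentry-stays n e = isEntry-false (pl (suc n)) (pl n) (hist n) (trans (sym (isEntryAt-suc n)) e)

    entry-formula : ∀ n → isEntryAt n ≡ true →
      (form (pl n) ≡ δ (state (pl n)) (T (node (pl n))) (topLetter (stack (pl n)))) ⊎ (n ≡ 0)
    entry-formula zero e = inj₂ refl
    entry-formula (suc n) e with entry-enters n e
    ... | y , q' , w' , eq rewrite eq = inj₁ refl

    lastEntry : ∀ i → Σ ℕ λ e → e ≤ i × isEntryAt e ≡ true × node (pl e) ≡ node (pl i)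
    lastEntry zero = 0 , z≤n , refl , refl
    lastEntry (suc i) with isEntryAt (suc i) in ei
    ... | true = suc i , ≤-refl , ei , refl
    ... | false with lastEntry i
    ...   | e , le , en , nd = e , m≤n⇒m≤1+n le , en , trans nd (sym (nonentry-stays i ei))

    not-reentered : ∀ {a b} → a < b → isEntryAt b ≡ true → node (pl a) ≡ node (pl b) → ⊥
    not-reentered {a} {suc b} (s≤s a≤b) eb nd with entry-descends b eb
    ... | y , eq = child-⋠ y (node (pl b)) (subst (_≼ node (pl b)) (trans nd eq) (descends a≤b))

    entry-unique : ∀ a b → isEntryAt a ≡ true → isEntryAt b ≡ true → node (pl a) ≡ node (pl b) → a ≡ b
    entry-unique a b ea eb nd with <-cmp a b
    ... | tri< a<b _ _ = ⊥-elim (not-reentered a<b eb nd)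
    ... | tri≈ _ a≡b _ = a≡b
    ... | tri> _ _ b<a = ⊥-elim (not-reentered b<a ea (sym nd))

    won-never-ff : EveWinsPlay pl → ∀ n → form (pl n) ≡ ffᶠ → ⊥
    won-never-ff (inj₂ (live , _)) n ff with trans (sym (stuck-ff (pl n) ff)) (live n)
    ... | ()
    won-never-ff (inj₁ (m , tt)) n ff with ≤-total n m
    ... | inj₁ n≤m with trans (sym tt) (trans (cong form (halted n (λ h → next-ff σ τ h (pl n) ff) n≤m)) ff)
    ...   | ()
    won-never-ff (inj₁ (m , tt)) n ff | inj₂ m≤n
      with trans (sym ff) (trans (cong form (halted m (λ h → next-tt σ τ h (pl m) tt) m≤n)) tt)
    ...   | ()

Parity : (ℕ → ℕ) → Set
Parity c = Σ ℕ λ e → (2 ∣ e)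
  × ((n : ℕ) → Σ ℕ λ n' → n ≤ n' × c n' ≡ e)
  × (Σ ℕ λ N → (n : ℕ) → N ≤ n → c n ≤ e)

-- c' is a stuttering of c: c n sits at position K n ≥ n of c', and every
-- colour of c' at position i repeats some c n with i ≤ 2n+1 (each step
-- of c is taken by at most two steps of c').
module Stuttering (c c' K : ℕ → ℕ) (n≤K : ∀ n → n ≤ K n) (c'∘K : ∀ n → c' (K n) ≡ c n)
                  (cover : ∀ i → Σ ℕ λ n → i ≤ suc (n + n) × c' i ≡ c n) where

  private
    halve : ∀ {a b} → suc (a + a) ≤ suc (b + b) → a ≤ b
    halve {a} {b} le with ≤-<-connex a b
    ... | inj₁ a≤b = a≤b
    ... | inj₂ b<a = ⊥-elim (<-irrefl refl (≤-trans (s≤s (+-mono-< b<a b<a)) le))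

  parity-stutter : Parity c → Parity c'
  parity-stutter (e , even , often , N , bound) = e , even , often' , suc (N + N) , bound'
    where
      often' : (i : ℕ) → Σ ℕ λ i' → i ≤ i' × c' i' ≡ e
      often' i with often i
      ... | n , i≤n , cn = K n , ≤-trans i≤n (n≤K n) , trans (c'∘K n) cn
      bound' : (i : ℕ) → suc (N + N) ≤ i → c' i ≤ e
      bound' i le with cover i
      ... | n , i≤ , c'i = subst (_≤ e) (sym c'i) (bound n (halve (≤-trans le i≤)))

  parity-unstutter : Parity c' → Parity c
  parity-unstutter (e , even , often , N , bound) = e , even , often' , N , bound'
    where
      often' : (n : ℕ) → Σ ℕ λ n' → n ≤ n' × c n' ≡ e
      often' n with often (suc (n + n))
      ... | i , le , c'i with cover i
      ...   | n' , i≤ , c'i≡ = n' , halve (≤-trans le i≤) , trans (sym c'i≡) c'i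
      bound' : (n : ℕ) → N ≤ n → c n ≤ e
      bound' n le = subst (_≤ e) (c'∘K n) (bound (K n) (≤-trans le (n≤K n)))

module Simulation {m d g k : ℕ} (N : CNPTA m d g k) (p : Fin m) (T : Tree m d) (u : Node d) (wι : Stacks g k) where
  A : CAPTA m d g k
  A = CNPTA.aut N

  A⇓ : CAPTA m d g k
  A⇓ = CNPTA.aut (N ⇓ p)

  open CAPTA A

  δ₁ δ₀ : Node d → Fin nQ → Stacks g k → PBF (Atom d nQ g k)
  δ₁ v q w = δ q (T v [ p ≔ true ]) (topLetter w)
  δ₀ v q w = δ q (T v [ p ≔ false ]) (topLetter w)

  δ-⊗ : ∀ (f : Node d → Bool) v q w →
    δ q ((T ⊗[ p ] f) v) (topLetter w) ≡ (if f v then δ₁ v q w else δ₀ v q w)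
  δ-⊗ f v q w with f v
  ... | true  = refl
  ... | false = refl

  isChoice : Node d → Fin nQ → Stacks g k → Bool
  isChoice v q w = not (isFF (δ₁ v q w)) ∧ not (isFF (δ₀ v q w))

  choice-∨ : ∀ v q w → isChoice v q w ≡ true → δ₁ v q w ∨? δ₀ v q w ≡ (δ₁ v q w ∨ᶠ δ₀ v q w)
  choice-∨ v q w c = ∨?-both (δ₁ v q w) (δ₀ v q w) (proj₁ (not-∧-not c)) (proj₂ (not-∧-not c))

  module G⇓ = Game A⇓ T
  module P⇓ = Plays A⇓ T

  guessPos : Node d → Fin nQ → Stacks g k → G⇓.Pos
  guessPos v q w = G⇓.pos v q w (δ₁ v q w ∨? δ₀ v q w)

  isChoiceAt⇓ : G⇓.Pos → Bool
  isChoiceAt⇓ P = isChoice (G⇓.node P) (G⇓.state P) (G⇓.stack P)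

  isGuess : G⇓.Pos → List G⇓.Pos → Bool
  isGuess P h = P⇓.isEntry P h ∧ isChoiceAt⇓ P

  module Labelled (f : Node d → Bool) where
    T⊗f : Tree m d
    T⊗f = T ⊗[ p ] f

    module G = Game A T⊗f
    module PL = Plays A T⊗f

    -- Positions of both games carry the same data.  The translations are
    -- opaque, used through the equations below: with-abstraction over moves
    -- is ill-typed once they are unfolded.
    opaque
      toG⇓ : G.Pos → G⇓.Pos
      toG⇓ P = G⇓.pos (G.node P) (G.state P) (G.stack P) (G.form P)

      fromG⇓ : G⇓.Pos → G.Pos
      fromG⇓ P = G.pos (G⇓.node P) (G⇓.state P) (G⇓.stack P) (G⇓.form P)

    opaque
      unfolding toG⇓
      toG⇓-pos : ∀ v q w φ → toG⇓ (G.pos v q w φ) ≡ G⇓.pos v q w φ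
      toG⇓-pos v q w φ = refl

      node-toG⇓ : ∀ P → G⇓.node (toG⇓ P) ≡ G.node P
      node-toG⇓ P = refl

      state-toG⇓ : ∀ P → G⇓.state (toG⇓ P) ≡ G.state P
      state-toG⇓ P = refl

      stack-toG⇓ : ∀ P → G⇓.stack (toG⇓ P) ≡ G.stack P
      stack-toG⇓ P = refl

      form-toG⇓ : ∀ P → G⇓.form (toG⇓ P) ≡ G.form P
      form-toG⇓ P = refl

    opaque
      unfolding toG⇓ fromG⇓
      fromG⇓-toG⇓ : ∀ P → fromG⇓ (toG⇓ P) ≡ P
      fromG⇓-toG⇓ P = refl

    guessOf : G.Pos → G⇓.Pos
    guessOf P = guessPos (G.node P) (G.state P) (G.stack P)

    isChoiceAt : G.Pos → Bool
    isChoiceAt P = isChoice (G.node P) (G.state P) (G.stack P)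

    stuck-toG⇓ : ∀ P → G⇓.stuck (toG⇓ P) ≡ G.stuck P
    stuck-toG⇓ (G.pos v q w φ) = trans (cong G⇓.stuck (toG⇓-pos v q w φ)) (same-stuck φ)
      where
        same-stuck : ∀ φ → G⇓.stuck (G⇓.pos v q w φ) ≡ G.stuck (G.pos v q w φ)
        same-stuck ttᶠ = refl
        same-stuck ffᶠ = refl
        same-stuck (atom (x , q' , op)) with applyOp op w
        ... | just _  = refl
        ... | nothing = refl
        same-stuck (φ ∧ᶠ ψ) = refl
        same-stuck (φ ∨ᶠ ψ) = refl

    choice-toG⇓ : ∀ P → isChoiceAt⇓ (toG⇓ P) ≡ isChoiceAt P
    choice-toG⇓ P = cong₂ (λ v (qw : Fin nQ × Stacks g k) → isChoice v (proj₁ qw) (proj₂ qw))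
                      (node-toG⇓ P) (cong₂ _,_ (state-toG⇓ P) (stack-toG⇓ P))

    isGuessEntry : G.Pos → List G.Pos → Bool
    isGuessEntry P h = PL.isEntry P h ∧ isChoiceAt P

    -- The N⇓p-history matching an N-history: each entry at which Eve has a
    -- genuine guess is preceded by the guess position.  liftBelow h P is the
    -- lift of the history P ∷ h without its head.
    lift : List G.Pos → List G⇓.Pos
    liftBelow : List G.Pos → G.Pos → List G⇓.Pos

    lift [] = []
    lift (P ∷ h) = toG⇓ P ∷ liftBelow h P

    liftBelow h P = if isGuessEntry P h then guessOf P ∷ lift h else lift h

    lower : List G⇓.Pos → List G.Pos
    lower [] = []
    lower (P ∷ h) = if isGuess P h then lower h else fromG⇓ P ∷ lower h

    liftBelow-guess : ∀ P h → isGuessEntry P h ≡ true → liftBelow h P ≡ guessOf P ∷ lift h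
    liftBelow-guess P h e = cong (λ b → if b then guessOf P ∷ lift h else lift h) e

    liftBelow-skip : ∀ P h → isGuessEntry P h ≡ false → liftBelow h P ≡ lift h
    liftBelow-skip P h e = cong (λ b → if b then guessOf P ∷ lift h else lift h) e

    entry-lift : ∀ (X : G⇓.Pos) (Y : G.Pos) h → G⇓.node X ≡ G.node Y →
      P⇓.isEntry X (lift h) ≡ PL.isEntry Y h
    entry-lift X Y [] e = refl
    entry-lift X Y (Q ∷ h) e = cong₂ (λ v w → not (does (v PL.≟ₙ w))) e (node-toG⇓ Q)

    lower-guess : ∀ P H → isGuess P H ≡ true → lower (P ∷ H) ≡ lower H
    lower-guess P H e = cong (λ b → if b then lower H else fromG⇓ P ∷ lower H) e

    lower-copy : ∀ P H → isGuess P H ≡ false → lower (P ∷ H) ≡ fromG⇓ P ∷ lower H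
    lower-copy P H e = cong (λ b → if b then lower H else fromG⇓ P ∷ lower H) e

    copy-not-guess : ∀ P h → isGuess (toG⇓ P) (liftBelow h P) ≡ false
    copy-not-guess P h = cases (isGuessEntry P h) refl
      where
        cases : ∀ b → isGuessEntry P h ≡ b → isGuess (toG⇓ P) (liftBelow h P) ≡ false
        cases true e = begin
          isGuess (toG⇓ P) (liftBelow h P)       ≡⟨ cong (isGuess (toG⇓ P)) (liftBelow-guess P h e) ⟩
          isGuess (toG⇓ P) (guessOf P ∷ lift h)
            ≡⟨ cong (_∧ isChoiceAt⇓ (toG⇓ P)) (P⇓.isEntry-same (toG⇓ P) (guessOf P) (lift h) (node-toG⇓ P)) ⟩
          false                                  ∎
          where open ≡-Reasoning
        cases false e = begin
          isGuess (toG⇓ P) (liftBelow h P) ≡⟨ cong (isGuess (toG⇓ P)) (liftBelow-skip P h e) ⟩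
          isGuess (toG⇓ P) (lift h)        ≡⟨ cong₂ _∧_ (entry-lift (toG⇓ P) P h (node-toG⇓ P)) (choice-toG⇓ P) ⟩
          isGuessEntry P h                 ≡⟨ e ⟩
          false                            ∎
          where open ≡-Reasoning

    lower-lift : ∀ h → lower (lift h) ≡ h
    lower-liftBelow : ∀ P h → lower (liftBelow h P) ≡ h

    lower-lift [] = refl
    lower-lift (P ∷ h) = begin
      lower (toG⇓ P ∷ liftBelow h P)         ≡⟨ lower-copy (toG⇓ P) (liftBelow h P) (copy-not-guess P h) ⟩
      fromG⇓ (toG⇓ P) ∷ lower (liftBelow h P) ≡⟨ cong₂ _∷_ (fromG⇓-toG⇓ P) (lower-liftBelow P h) ⟩
      P ∷ h                                   ∎
      where open ≡-Reasoning

    lower-liftBelow P h = cases (isGuessEntry P h) refl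
      where
        cases : ∀ b → isGuessEntry P h ≡ b → lower (liftBelow h P) ≡ h
        cases true e = begin
          lower (liftBelow h P)       ≡⟨ cong lower (liftBelow-guess P h e) ⟩
          lower (guessOf P ∷ lift h)  ≡⟨ lower-guess (guessOf P) (lift h)
                                           (trans (cong (_∧ isChoiceAt P) (entry-lift (guessOf P) P h refl)) e) ⟩
          lower (lift h)              ≡⟨ lower-lift h ⟩
          h                           ∎
          where open ≡-Reasoning
        cases false e = trans (cong lower (liftBelow-skip P h e)) (lower-lift h)

    guessed : G⇓.Strategy → G.Pos → List G⇓.Pos → PBF (Atom d nQ g k)
    guessed σ⇓ P H =
      if σ⇓ (guessOf P ∷ H) then δ₁ (G.node P) (G.state P) (G.stack P) else δ₀ (G.node P) (G.state P) (G.stack P)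

    afterGuess : G⇓.Strategy → G.Pos → List G⇓.Pos → PBF (Atom d nQ g k)
    afterGuess σ⇓ P H = if isChoiceAt P then guessed σ⇓ P H else G⇓.form (guessOf P)

    afterGuess-choice : ∀ σ⇓ P H → isChoiceAt P ≡ true → afterGuess σ⇓ P H ≡ guessed σ⇓ P H
    afterGuess-choice σ⇓ P H c = cong (λ b → if b then guessed σ⇓ P H else G⇓.form (guessOf P)) c

    afterGuess-forced : ∀ σ⇓ P H → isChoiceAt P ≡ false → afterGuess σ⇓ P H ≡ G⇓.form (guessOf P)
    afterGuess-forced σ⇓ P H c = cong (λ b → if b then guessed σ⇓ P H else G⇓.form (guessOf P)) c

    module Coupled (σ τ : G.Strategy) (σ⇓ τ⇓ : G⇓.Strategy)
                   (eve-agrees : ∀ P h → σ⇓ (lift (P ∷ h)) ≡ σ (P ∷ h))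
                   (adam-agrees : ∀ P h → τ⇓ (lift (P ∷ h)) ≡ τ (P ∷ h)) where

      CoupledMove : G.Pos → List G.Pos → G⇓.Pos → List G⇓.Pos → Set
      CoupledMove P h X H =
        (G.node (G.next σ τ h P) ≡ G.node P × G⇓.next σ⇓ τ⇓ H X ≡ toG⇓ (G.next σ τ h P))
        ⊎ (Σ (Fin (suc d)) λ y → Σ (Fin nQ) λ q' → Σ (Stacks g k) λ w' →
             G.next σ τ h P ≡ G.pos (y ∷ G.node P) q' w' (δ q' (T⊗f (y ∷ G.node P)) (topLetter w'))
             × G⇓.next σ⇓ τ⇓ H X ≡ guessPos (y ∷ G.node P) q' w')

      private
        same : ∀ v q w φ → G⇓.pos v q w φ ≡ toG⇓ (G.pos v q w φ)
        same v q w φ = sym (toG⇓-pos v q w φ)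

      coupled-move₀ : ∀ v q w φ h H → G⇓.pos v q w φ ∷ H ≡ lift (G.pos v q w φ ∷ h) →
        CoupledMove (G.pos v q w φ) h (G⇓.pos v q w φ) H
      coupled-move₀ v q w ttᶠ h H _ = inj₁ (refl , same v q w ttᶠ)
      coupled-move₀ v q w ffᶠ h H _ = inj₁ (refl , same v q w ffᶠ)
      coupled-move₀ v q w (atom (x , q' , op)) h H _ with applyOp op w
      ... | just w' = inj₂ (x , q' , w' , refl , refl)
      ... | nothing = inj₁ (refl , same v q w (atom (x , q' , op)))
      coupled-move₀ v q w (a ∨ᶠ b) h H e
        with σ⇓ (G⇓.pos v q w (a ∨ᶠ b) ∷ H) in e⇓ | σ (G.pos v q w (a ∨ᶠ b) ∷ h) in e₁
      ... | true  | true  = inj₁ (refl , same v q w a)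
      ... | false | false = inj₁ (refl , same v q w b)
      ... | true  | false = ⊥-elim (true≢false (trans (sym e⇓) (trans (cong σ⇓ e) (trans (eve-agrees _ h) e₁))))
      ... | false | true  = ⊥-elim (true≢false (trans (sym e₁) (trans (sym (eve-agrees _ h)) (trans (sym (cong σ⇓ e)) e⇓))))
      coupled-move₀ v q w (a ∧ᶠ b) h H e
        with τ⇓ (G⇓.pos v q w (a ∧ᶠ b) ∷ H) in e⇓ | τ (G.pos v q w (a ∧ᶠ b) ∷ h) in e₁
      ... | true  | true  = inj₁ (refl , same v q w a)
      ... | false | false = inj₁ (refl , same v q w b)
      ... | true  | false = ⊥-elim (true≢false (trans (sym e⇓) (trans (cong τ⇓ e) (trans (adam-agrees _ h) e₁))))
      ... | false | true  = ⊥-elim (true≢false (trans (sym e₁) (trans (sym (adam-agrees _ h)) (trans (sym (cong τ⇓ e)) e⇓))))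

      coupled-move : ∀ P h → CoupledMove P h (toG⇓ P) (liftBelow h P)
      coupled-move (G.pos v q w φ) h =
        subst (λ X → CoupledMove (G.pos v q w φ) h X (liftBelow h (G.pos v q w φ))) (same v q w φ)
          (coupled-move₀ v q w φ h (liftBelow h (G.pos v q w φ)) (cong (_∷ liftBelow h (G.pos v q w φ)) (same v q w φ)))

      p₀ : G.Pos
      p₀ = G.initial wι u

      p₀⇓ : G⇓.Pos
      p₀⇓ = G⇓.initial wι u

      module R = PL.Run σ τ p₀
      module R⇓ = P⇓.Run σ⇓ τ⇓ p₀⇓

      run⇓ : ℕ → List G⇓.Pos × G⇓.Pos
      run⇓ = G⇓.run σ⇓ τ⇓ p₀⇓

      Synced : ℕ → ℕ → Set
      Synced n K = run⇓ K ≡ (liftBelow (R.hist n) (R.pl n) , toG⇓ (R.pl n))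

      GuessAt : ℕ → ℕ → Set
      GuessAt i n = R⇓.pl i ≡ guessOf (R.pl n) × isChoiceAt (R.pl n) ≡ true

      Arrived : ℕ → ℕ → Set
      Arrived n K = Σ ℕ λ K' → Synced n K' × ((K' ≡ K) ⊎ (K' ≡ suc K × GuessAt K n))

      GuessesMatch : Set
      GuessesMatch = ∀ n K → run⇓ K ≡ (lift (R.hist n) , guessOf (R.pl n)) → R.isEntryAt n ≡ true →
        afterGuess σ⇓ (R.pl n) (lift (R.hist n)) ≡ G.form (R.pl n)

      entry-form : ∀ n → R.isEntryAt n ≡ true →
        G.form (R.pl n) ≡ (if f (G.node (R.pl n)) then δ₁ (G.node (R.pl n)) (G.state (R.pl n)) (G.stack (R.pl n))
                                                  else δ₀ (G.node (R.pl n)) (G.state (R.pl n)) (G.stack (R.pl n)))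
      entry-form n entry with R.entry-formula n entry
      ... | inj₁ e = trans e (δ-⊗ f (G.node (R.pl n)) (G.state (R.pl n)) (G.stack (R.pl n)))
      ... | inj₂ refl = δ-⊗ f u qι wι

      module Synchronised (match : GuessesMatch) where

        enter : ∀ n K → run⇓ K ≡ (lift (R.hist n) , guessOf (R.pl n)) → R.isEntryAt n ≡ true → Arrived n K
        enter n K at-guess entry = cases (isChoiceAt P) refl
          where
            P : G.Pos
            P = R.pl n
            h : List G.Pos
            h = R.hist n
            v : Node d
            v = G.node P
            q : Fin nQ
            q = G.state P
            w : Stacks g k
            w = G.stack P

            cases : ∀ b → isChoiceAt P ≡ b → Arrived n K
            cases false no-choice = K , trans at-guess (cong₂ _,_ (sym lifted) guess-is-copy) , inj₁ refl
              where
                lifted : liftBelow h P ≡ lift h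
                lifted = liftBelow-skip P h (cong₂ _∧_ entry no-choice)
                forced : G⇓.form (guessOf P) ≡ G.form P
                forced = trans (sym (afterGuess-forced σ⇓ P (lift h) no-choice)) (match n K at-guess entry)
                guess-is-copy : guessOf P ≡ toG⇓ P
                guess-is-copy = trans (cong (G⇓.pos v q w) forced) (sym (toG⇓-pos v q w (G.form P)))
            cases true choice = suc K , synced , inj₂ (refl , cong proj₂ at-guess , choice)
              where
                lifted : liftBelow h P ≡ guessOf P ∷ lift h
                lifted = liftBelow-guess P h (cong₂ _∧_ entry choice)
                guess-∨ : guessOf P ≡ G⇓.pos v q w (δ₁ v q w ∨ᶠ δ₀ v q w)
                guess-∨ = cong (G⇓.pos v q w) (choice-∨ v q w choice)
                chosen : guessed σ⇓ P (lift h) ≡ G.form P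
                chosen = trans (sym (afterGuess-choice σ⇓ P (lift h) choice)) (match n K at-guess entry)
                after : G⇓.next σ⇓ τ⇓ (lift h) (guessOf P) ≡ toG⇓ P
                after = begin
                    G⇓.next σ⇓ τ⇓ (lift h) (guessOf P)
                  ≡⟨ cong (G⇓.next σ⇓ τ⇓ (lift h)) guess-∨ ⟩
                    G⇓.next σ⇓ τ⇓ (lift h) (G⇓.pos v q w (δ₁ v q w ∨ᶠ δ₀ v q w))
                  ≡⟨ P⇓.next-∨ σ⇓ τ⇓ (lift h) v q w (δ₁ v q w) (δ₀ v q w) ⟩
                    G⇓.pos v q w (if σ⇓ (G⇓.pos v q w (δ₁ v q w ∨ᶠ δ₀ v q w) ∷ lift h) then δ₁ v q w else δ₀ v q w)
                  ≡⟨ cong (λ X → G⇓.pos v q w (if σ⇓ (X ∷ lift h) then δ₁ v q w else δ₀ v q w)) (sym guess-∨) ⟩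
                    G⇓.pos v q w (if σ⇓ (guessOf P ∷ lift h) then δ₁ v q w else δ₀ v q w)
                  ≡⟨ cong (G⇓.pos v q w) chosen ⟩
                    G⇓.pos v q w (G.form P)
                  ≡⟨ sym (toG⇓-pos v q w (G.form P)) ⟩
                    toG⇓ P ∎
                  where open ≡-Reasoning
                synced : Synced n (suc K)
                synced = trans (R⇓.run-step at-guess) (cong₂ _,_ (sym lifted) after)

        step : ∀ n K → Synced n K → Arrived (suc n) (suc K)
        step n K synced with coupled-move (R.pl n) (R.hist n)
        ... | inj₁ (stays , move⇓) = suc K , synced' , inj₁ refl
          where
            P : G.Pos
            P = R.pl n
            h : List G.Pos
            h = R.hist n
            Q : G.Pos
            Q = G.next σ τ h P
            synced' : Synced (suc n) (suc K)
            synced' = begin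
                run⇓ (suc K)
              ≡⟨ R⇓.run-step synced ⟩
                (lift (P ∷ h) , G⇓.next σ⇓ τ⇓ (liftBelow h P) (toG⇓ P))
              ≡⟨ cong₂ _,_ (sym (liftBelow-skip Q (P ∷ h) (cong (_∧ isChoiceAt Q) (PL.isEntry-same Q P h stays))))
                           move⇓ ⟩
                (liftBelow (P ∷ h) Q , toG⇓ Q)
              ≡⟨ cong₂ (λ h' Q' → (liftBelow h' Q' , toG⇓ Q')) (sym (R.hist-suc n)) (sym (R.pl-suc n)) ⟩
                (liftBelow (R.hist (suc n)) (R.pl (suc n)) , toG⇓ (R.pl (suc n)))
              ∎
              where open ≡-Reasoning
        ... | inj₂ (y , q' , w' , moveN , move⇓) = enter (suc n) (suc K) at-guess entry
          where
            P : G.Pos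
            P = R.pl n
            h : List G.Pos
            h = R.hist n
            at-guess : run⇓ (suc K) ≡ (lift (R.hist (suc n)) , guessOf (R.pl (suc n)))
            at-guess = begin
                run⇓ (suc K)
              ≡⟨ R⇓.run-step synced ⟩
                (lift (P ∷ h) , G⇓.next σ⇓ τ⇓ (liftBelow h P) (toG⇓ P))
              ≡⟨ cong₂ _,_ refl (trans move⇓ (sym (cong guessOf moveN))) ⟩
                (lift (P ∷ h) , guessOf (G.next σ τ h P))
              ≡⟨ cong₂ (λ h' Q' → (lift h' , guessOf Q')) (sym (R.hist-suc n)) (sym (R.pl-suc n)) ⟩
                (lift (R.hist (suc n)) , guessOf (R.pl (suc n)))
              ∎
              where open ≡-Reasoning
            entry : R.isEntryAt (suc n) ≡ true
            entry = trans (R.isEntryAt-suc n) (PL.isEntry-diff (R.pl (suc n)) P h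
                      (λ e → no-proper-cycle [] y (G.node P)
                               (sym (trans (sym (cong G.node (trans (sym (R.pl-suc n)) moveN))) e))))

        sync : (n : ℕ) → Σ ℕ (Arrived n)
        sync zero = 0 , enter 0 0 refl refl
        sync (suc n) = suc (proj₁ (proj₂ (sync n))) , step n (proj₁ (proj₂ (sync n))) (proj₁ (proj₂ (proj₂ (sync n))))

        start copy : ℕ → ℕ
        start n = proj₁ (sync n)
        copy n = proj₁ (proj₂ (sync n))

        synced : ∀ n → Synced n (copy n)
        synced n = proj₁ (proj₂ (proj₂ (sync n)))

        arrival : ∀ n → (copy n ≡ start n) ⊎ (copy n ≡ suc (start n) × GuessAt (start n) n)
        arrival n = proj₂ (proj₂ (proj₂ (sync n)))

        copy-pos : ∀ n → R⇓.pl (copy n) ≡ toG⇓ (R.pl n)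
        copy-pos n = cong proj₂ (synced n)

        start≤copy : ∀ n → start n ≤ copy n
        start≤copy n with arrival n
        ... | inj₁ e = ≤-reflexive (sym e)
        ... | inj₂ (e , _) = ≤-trans (n≤1+n (start n)) (≤-reflexive (sym e))

        copy≤ : ∀ n → copy n ≤ suc (start n)
        copy≤ n with arrival n
        ... | inj₁ e = ≤-trans (≤-reflexive e) (n≤1+n (start n))
        ... | inj₂ (e , _) = ≤-reflexive e

        n≤copy : ∀ n → n ≤ copy n
        n≤copy zero = z≤n
        n≤copy (suc n) = ≤-trans (s≤s (n≤copy n)) (start≤copy (suc n))

        copy≤2n+1 : ∀ n → copy n ≤ suc (n + n)
        copy≤2n+1 zero = copy≤ zero
        copy≤2n+1 (suc n) = ≤-trans (copy≤ (suc n)) (s≤s (≤-trans (s≤s (copy≤2n+1 n)) (≤-reflexive (cong suc (sym (+-suc n n))))))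

        Covered : ℕ → Set
        Covered i = Σ ℕ λ n → i ≤ suc (n + n) × ((R⇓.pl i ≡ toG⇓ (R.pl n)) ⊎ GuessAt i n)

        covered-at : ∀ n i → start n ≤ i → i ≤ copy n → (R⇓.pl i ≡ toG⇓ (R.pl n)) ⊎ GuessAt i n
        covered-at n i s≤i i≤c with arrival n
        ... | inj₁ c≡s =
          inj₁ (subst (λ j → R⇓.pl j ≡ toG⇓ (R.pl n)) (≤-antisym (subst (_≤ i) (sym c≡s) s≤i) i≤c) (copy-pos n))
        ... | inj₂ (c≡1+s , guess) with i ≟ start n
        ...   | yes i≡s = inj₂ (subst (λ j → GuessAt j n) (sym i≡s) guess)
        ...   | no i≢s = inj₁ (subst (λ j → R⇓.pl j ≡ toG⇓ (R.pl n)) c≡i (copy-pos n))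
          where
            c≡i : copy n ≡ i
            c≡i = ≤-antisym (subst (_≤ i) (sym c≡1+s) (≤∧≢⇒< s≤i (λ e → i≢s (sym e)))) i≤c

        covered-below : ∀ n i → i ≤ copy n → Covered i
        covered-before : ∀ n i → i < start n → Covered i

        covered-below n i i≤c with start n ≤? i
        ... | yes s≤i = n , ≤-trans i≤c (copy≤2n+1 n) , covered-at n i s≤i i≤c
        ... | no s≰i = covered-before n i (≰⇒> s≰i)

        covered-before (suc n) i (s≤s i≤c) = covered-below n i i≤c

        covered : ∀ i → Covered i
        covered i = covered-below i i (n≤copy i)

        colour colour⇓ : ℕ → ℕ
        colour n = C (G.state (R.pl n))
        colour⇓ i = C (G⇓.state (R⇓.pl i))

        colour-copy : ∀ n → colour⇓ (copy n) ≡ colour n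
        colour-copy n = cong C (trans (cong G⇓.state (copy-pos n)) (state-toG⇓ (R.pl n)))

        colour-covered : ∀ i → Σ ℕ λ n → i ≤ suc (n + n) × colour⇓ i ≡ colour n
        colour-covered i with covered i
        ... | n , le , inj₁ e = n , le , cong C (trans (cong G⇓.state e) (state-toG⇓ (R.pl n)))
        ... | n , le , inj₂ (e , _) = n , le , cong C (cong G⇓.state e)

        open Stuttering colour colour⇓ copy n≤copy colour-copy colour-covered

        guess-live : ∀ P → isChoiceAt P ≡ true → G⇓.stuck (guessOf P) ≡ false
        guess-live P c = cong (λ φ → G⇓.stuck (G⇓.pos (G.node P) (G.state P) (G.stack P) φ))
                              (choice-∨ (G.node P) (G.state P) (G.stack P) c)

        guess-not-tt : ∀ P → isChoiceAt P ≡ true → G⇓.form (guessOf P) ≢ ttᶠ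
        guess-not-tt P c e with trans (sym (choice-∨ (G.node P) (G.state P) (G.stack P) c)) e
        ... | ()

        win⇓ : G.EveWinsPlay R.pl → G⇓.EveWinsPlay R⇓.pl
        win⇓ (inj₁ (n , tt)) = inj₁ (copy n , trans (cong G⇓.form (copy-pos n)) (trans (form-toG⇓ (R.pl n)) tt))
        win⇓ (inj₂ (live , parity)) = inj₂ (live⇓ , parity-stutter parity)
          where
            live⇓ : ∀ i → G⇓.stuck (R⇓.pl i) ≡ false
            live⇓ i with covered i
            ... | n , _ , inj₁ e = trans (cong G⇓.stuck e) (trans (stuck-toG⇓ (R.pl n)) (live n))
            ... | n , _ , inj₂ (e , c) = trans (cong G⇓.stuck e) (guess-live (R.pl n) c)

        win⇑ : G⇓.EveWinsPlay R⇓.pl → G.EveWinsPlay R.pl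
        win⇑ (inj₁ (i , tt)) with covered i
        ... | n , _ , inj₁ e = inj₁ (n , trans (sym (form-toG⇓ (R.pl n))) (trans (cong G⇓.form (sym e)) tt))
        ... | n , _ , inj₂ (e , c) = ⊥-elim (guess-not-tt (R.pl n) c (trans (cong G⇓.form (sym e)) tt))
        win⇑ (inj₂ (live⇓ , parity)) = inj₂ (live , parity-unstutter parity)
          where
            live : ∀ n → G.stuck (R.pl n) ≡ false
            live n = trans (sym (stuck-toG⇓ (R.pl n))) (trans (cong G⇓.stuck (sym (copy-pos n))) (live⇓ (copy n)))

module LabellingToStrategy {m d g k : ℕ} (N : CNPTA m d g k) (p : Fin m) (T : Tree m d) (u : Node d) (wι : Stacks g k)
                           (f : Node d → Bool) where
  open Simulation N p T u wι
  open Labelled f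
  open CAPTA A

  guessing : G.Strategy → G⇓.Strategy
  guessing σ [] = true
  guessing σ (P ∷ H) = if isGuess P H then f (G⇓.node P) else σ (lower (P ∷ H))

  guessing-lift : ∀ σ P h → guessing σ (lift (P ∷ h)) ≡ σ (P ∷ h)
  guessing-lift σ P h = begin
      guessing σ (toG⇓ P ∷ liftBelow h P)
    ≡⟨ cong (λ b → if b then f (G⇓.node (toG⇓ P)) else σ (lower (lift (P ∷ h)))) (copy-not-guess P h) ⟩
      σ (lower (lift (P ∷ h)))
    ≡⟨ cong σ (lower-lift (P ∷ h)) ⟩
      σ (P ∷ h)
    ∎
    where open ≡-Reasoning

  labelling⇒accept : Accepts A wι T⊗f u → Accepts A⇓ wι T u
  labelling⇒accept (σ , win) = guessing σ , win-guessing
    where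
      σ⇓ : G⇓.Strategy
      σ⇓ = guessing σ

      win-guessing : (τ⇓ : G⇓.Strategy) → G⇓.EveWinsPlay (G⇓.play σ⇓ τ⇓ (G⇓.initial wι u))
      win-guessing τ⇓ = win⇓ (win τ)
        where
          τ : G.Strategy
          τ h = τ⇓ (lift h)

          open Coupled σ τ σ⇓ τ⇓ (guessing-lift σ) (λ P h → refl)

          match : GuessesMatch
          match n K _ entry = cases (isChoiceAt P) refl
            where
              P : G.Pos
              P = R.pl n
              h : List G.Pos
              h = R.hist n
              v : Node d
              v = G.node P
              q : Fin nQ
              q = G.state P
              w : Stacks g k
              w = G.stack P
              cases : ∀ b → isChoiceAt P ≡ b → afterGuess σ⇓ P (lift h) ≡ G.form P
              cases true c = begin
                  afterGuess σ⇓ P (lift h)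
                ≡⟨ afterGuess-choice σ⇓ P (lift h) c ⟩
                  guessed σ⇓ P (lift h)
                ≡⟨ cong (λ b → if b then δ₁ v q w else δ₀ v q w) guess-f ⟩
                  (if f v then δ₁ v q w else δ₀ v q w)
                ≡⟨ sym (entry-form n entry) ⟩
                  G.form P
                ∎
                where
                  open ≡-Reasoning
                  guess-f : σ⇓ (guessOf P ∷ lift h) ≡ f v
                  guess-f = cong (λ b → if b then f v else σ (lower (guessOf P ∷ lift h)))
                              (trans (cong (_∧ isChoiceAt P) (entry-lift (guessOf P) P h refl)) (cong₂ _∧_ entry c))
              cases false c = begin
                  afterGuess σ⇓ P (lift h)
                ≡⟨ afterGuess-forced σ⇓ P (lift h) c ⟩
                  δ₁ v q w ∨? δ₀ v q w
                ≡⟨ ∨?-forced (δ₁ v q w) (δ₀ v q w) (f v) c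
                     (λ ff → R.won-never-ff (win τ) n (trans (entry-form n entry) ff)) ⟩
                  (if f v then δ₁ v q w else δ₀ v q w)
                ≡⟨ sym (entry-form n entry) ⟩
                  G.form P
                ∎
                where open ≡-Reasoning

          open Synchronised match

-- In a nondeterministic formula no conjunction has atoms of the same
-- direction on both sides, so a direction determines Adam's choices.

module _ {d nQ g k : ℕ} where

  hasDir : Fin (suc d) → PBF (Atom d nQ g k) → Bool
  hasDir x (atom (y , _)) = does (y ≟ᶠ x)
  hasDir x (φ ∧ᶠ ψ) = hasDir x φ ∨ hasDir x ψ
  hasDir x (φ ∨ᶠ ψ) = hasDir x φ ∨ hasDir x ψ
  hasDir x ttᶠ = false
  hasDir x ffᶠ = false

  Unambiguous : Fin (suc d) → PBF (Atom d nQ g k) → Set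
  Unambiguous x (φ ∧ᶠ ψ) = Unambiguous x φ × Unambiguous x ψ × (hasDir x φ ≡ true → hasDir x ψ ≡ false)
  Unambiguous x (φ ∨ᶠ ψ) = Unambiguous x φ × Unambiguous x ψ
  Unambiguous x _ = ⊤

  countDir-++ : ∀ x (φs ψs : List (PBF (Atom d nQ g k))) →
    countDir x (φs ++ ψs) ≡ countDir x φs + countDir x ψs
  countDir-++ x [] ψs = refl
  countDir-++ x (atom (y , _) ∷ φs) ψs with does (y ≟ᶠ x)
  ... | true  = cong suc (countDir-++ x φs ψs)
  ... | false = countDir-++ x φs ψs
  countDir-++ x (ttᶠ ∷ φs) ψs = countDir-++ x φs ψs
  countDir-++ x (ffᶠ ∷ φs) ψs = countDir-++ x φs ψs
  countDir-++ x ((_ ∧ᶠ _) ∷ φs) ψs = countDir-++ x φs ψs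
  countDir-++ x ((_ ∨ᶠ _) ∷ φs) ψs = countDir-++ x φs ψs

  hasDir-count : ∀ x (φ : PBF (Atom d nQ g k)) → All IsAtom (conjuncts φ) → hasDir x φ ≡ true →
    1 ≤ countDir x (conjuncts φ)
  hasDir-count x (atom _) atoms e rewrite e = s≤s z≤n
  hasDir-count x (φ ∧ᶠ ψ) atoms e rewrite countDir-++ x (conjuncts φ) (conjuncts ψ) with hasDir x φ in eφ
  ... | true  = ≤-trans (hasDir-count x φ (++⁻ˡ (conjuncts φ) atoms) eφ) (m≤m+n _ _)
  ... | false = ≤-trans (hasDir-count x ψ (++⁻ʳ (conjuncts φ) atoms) e) (m≤n+m _ _)
  hasDir-count x (_ ∨ᶠ _) (() ∷ _) _

  conjunction-unambiguous : ∀ x (φ : PBF (Atom d nQ g k)) → All IsAtom (conjuncts φ) →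
    countDir x (conjuncts φ) ≤ 1 → Unambiguous x φ
  conjunction-unambiguous x (atom _) _ _ = _
  conjunction-unambiguous x (φ ∧ᶠ ψ) atoms once =
    conjunction-unambiguous x φ atomsφ (≤-trans (m≤m+n _ _) split) ,
    conjunction-unambiguous x ψ atomsψ (≤-trans (m≤n+m _ _) split) ,
    exclusive
    where
      atomsφ : All IsAtom (conjuncts φ)
      atomsφ = ++⁻ˡ (conjuncts φ) atoms
      atomsψ : All IsAtom (conjuncts ψ)
      atomsψ = ++⁻ʳ (conjuncts φ) atoms
      split : countDir x (conjuncts φ) + countDir x (conjuncts ψ) ≤ 1
      split = ≤-trans (≤-reflexive (sym (countDir-++ x (conjuncts φ) (conjuncts ψ)))) once
      exclusive : hasDir x φ ≡ true → hasDir x ψ ≡ false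
      exclusive eφ with hasDir x ψ in eψ
      ... | false = refl
      ... | true = ⊥-elim (<-irrefl refl (≤-trans (+-mono-≤ (hasDir-count x φ atomsφ eφ) (hasDir-count x ψ atomsψ eψ)) split))
  conjunction-unambiguous x ttᶠ (() ∷ _) _
  conjunction-unambiguous x ffᶠ (() ∷ _) _
  conjunction-unambiguous x (_ ∨ᶠ _) (() ∷ _) _

  disjunction-unambiguous : ∀ x (φ : PBF (Atom d nQ g k)) → All OneAtomPerDirection (disjuncts φ) → Unambiguous x φ
  disjunction-unambiguous x (φ ∨ᶠ ψ) ds =
    disjunction-unambiguous x φ (++⁻ˡ (disjuncts φ) ds) , disjunction-unambiguous x ψ (++⁻ʳ (disjuncts φ) ds)
  disjunction-unambiguous x (φ ∧ᶠ ψ) ((atoms , once) ∷ []) =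
    conjunction-unambiguous x (φ ∧ᶠ ψ) atoms (≤-reflexive (once x))
  disjunction-unambiguous x (atom _) _ = _
  disjunction-unambiguous x ttᶠ _ = _
  disjunction-unambiguous x ffᶠ _ = _

  nondet-unambiguous : ∀ {φ : PBF (Atom d nQ g k)} → NondetFormula φ → ∀ x → Unambiguous x φ
  nondet-unambiguous (inj₁ refl) x = _
  nondet-unambiguous {φ} (inj₂ ds) x = disjunction-unambiguous x φ ds

-- Under a fixed strategy of Eve, the history with which the play enters a
-- node does not depend on Adam: his choices are forced by the direction
-- of the node.

module Descent {m d g k : ℕ} (A : CAPTA m d g k) (T : Tree m d) (σ : Game.Strategy A T)
               (unambiguous : ∀ q a γ x → Unambiguous x (CAPTA.δ A q a γ)) where
  open CAPTA A
  open Game A T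
  open Plays A T

  History : Set
  History = List Pos × Pos

  walk : Fin (suc d) → List Pos → Node d → Fin nQ → Stacks g k → PBF (Atom d nQ g k) → Maybe History
  walkAt : Fin (suc d) → List Pos → Node d → Fin nQ → Stacks g k →
    PBF (Atom d nQ g k) → PBF (Atom d nQ g k) → Bool → Maybe History

  walk x h v q w ttᶠ = nothing
  walk x h v q w ffᶠ = nothing
  walk x h v q w (atom (y , q' , op)) with does (y ≟ᶠ x) | applyOp op w
  ... | true  | just w' = just (pos v q w (atom (y , q' , op)) ∷ h , pos (y ∷ v) q' w' (δ q' (T (y ∷ v)) (topLetter w')))
  ... | true  | nothing = nothing
  ... | false | _       = nothing
  walk x h v q w (φ ∨ᶠ ψ) = walkAt x (pos v q w (φ ∨ᶠ ψ) ∷ h) v q w φ ψ (σ (pos v q w (φ ∨ᶠ ψ) ∷ h))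
  walk x h v q w (φ ∧ᶠ ψ) = walkAt x (pos v q w (φ ∧ᶠ ψ) ∷ h) v q w φ ψ (hasDir x φ)

  walkAt x h v q w φ ψ b = if b then walk x h v q w φ else walk x h v q w ψ

  walkFrom : Fin (suc d) → Maybe History → Maybe History
  walkFrom x nothing = nothing
  walkFrom x (just (h , P)) = walk x h (node P) (state P) (stack P) (form P)

  module FromRoot (u : Node d) (wι : Stacks g k) where
    p₀ : Pos
    p₀ = initial wι u

    -- the history with which the play from p₀ enters v, if it does
    historyAt : Node d → Maybe History
    historyAt [] = if does ([] ≟ₙ u) then just ([] , p₀) else nothing
    historyAt (x ∷ v) = if does ((x ∷ v) ≟ₙ u) then just ([] , p₀) else walkFrom x (historyAt v)

    historyAt-root : ∀ v → v ≡ u → historyAt v ≡ just ([] , p₀)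
    historyAt-root [] e with [] ≟ₙ u
    ... | yes _ = refl
    ... | no ne = ⊥-elim (ne e)
    historyAt-root (x ∷ v) e with (x ∷ v) ≟ₙ u
    ... | yes _ = refl
    ... | no ne = ⊥-elim (ne e)

    historyAt-below : ∀ x xs → historyAt (x ∷ xs ++ u) ≡ walkFrom x (historyAt (xs ++ u))
    historyAt-below x xs with (x ∷ xs ++ u) ≟ₙ u
    ... | no _ = refl
    ... | yes e with ++-identityˡ-unique (x ∷ xs) (sym e)
    ...   | ()

    module _ (τ : Strategy) where
      open Run σ τ p₀

      moved-on : ∀ {x i j h v q w φ} → run σ τ p₀ i ≡ (h , pos v q w φ) → i ≤ j → (x ∷ v) ≼ node (pl j) → suc i ≤ j
      moved-on {x} {v = v} at i≤j below with m≤n⇒m<n∨m≡n i≤j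
      ... | inj₁ i<j = i<j
      ... | inj₂ refl = ⊥-elim (child-⋠ x v (subst ((x ∷ v) ≼_) (cong (node ∘ proj₂) at) below))

      never-below : ∀ {x v i j} → node (pl i) ≡ v → (∀ h → next σ τ h (pl i) ≡ pl i) → i ≤ j →
        (x ∷ v) ≼ node (pl j) → ⊥
      never-below {x} {v} {i} at fix i≤j below =
        child-⋠ x v (subst ((x ∷ v) ≼_) (trans (cong node (halted i fix i≤j)) at) below)

      Found : Fin (suc d) → List Pos → Node d → Fin nQ → Stacks g k → PBF (Atom d nQ g k) → Set
      Found x h v q w φ = Σ ℕ λ s → walk x h v q w φ ≡ just (run σ τ p₀ s)
        × node (pl s) ≡ x ∷ v × isEntryAt s ≡ true × hasDir x φ ≡ true

      -- at an atom, the play either halts or enters the atom's child,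
      -- which must then be x ∷ v
      walk-finds-atom : ∀ x y q' op i h v q w → run σ τ p₀ i ≡ (h , pos v q w (atom (y , q' , op))) →
        ∀ j → i ≤ j → (x ∷ v) ≼ node (pl j) → Found x h v q w (atom (y , q' , op))
      walk-finds-atom x y q' op i h v q w at j i≤j below with applyOp op w in eo
      ... | nothing = ⊥-elim (never-below (cong (node ∘ proj₂) at) blocked i≤j below)
        where
          blocked : ∀ h' → next σ τ h' (pl i) ≡ pl i
          blocked h' = trans (cong (next σ τ h') (cong proj₂ at))
                             (trans (next-blocked σ τ h' v q w y q' op eo) (sym (cong proj₂ at)))
      ... | just w' with y ≟ᶠ x
      ...   | yes refl = suc i , cong just (sym entered) , cong (node ∘ proj₂) entered , entry , refl
        where
          entered : run σ τ p₀ (suc i) ≡ (pos v q w (atom (y , q' , op)) ∷ h ,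
                                         pos (y ∷ v) q' w' (δ q' (T (y ∷ v)) (topLetter w')))
          entered = run-move at (next-atom σ τ h v q w y q' op w' eo)
          entry : isEntryAt (suc i) ≡ true
          entry = trans (isEntryAt-suc i) (isEntry-diff (pl (suc i)) (pl i) (hist i)
                    (λ e → no-proper-cycle [] y v
                             (sym (trans (sym (cong (node ∘ proj₂) entered)) (trans e (cong (node ∘ proj₂) at))))))
      ...   | no y≢x = ⊥-elim (y≢x (child-unique below-y below))
        where
          entered : node (pl (suc i)) ≡ y ∷ v
          entered = cong (node ∘ proj₂) (run-move at (next-atom σ τ h v q w y q' op w' eo))
          below-y : (y ∷ v) ≼ node (pl j)
          below-y = subst (_≼ node (pl j)) entered (descends (moved-on at i≤j below))

      -- by induction on the formula; at a conjunction, Adam's choice must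
      -- be the side containing x, since the play enters x ∷ v
      walk-finds : ∀ x φ i h v q w → run σ τ p₀ i ≡ (h , pos v q w φ) → Unambiguous x φ →
        ∀ j → i ≤ j → (x ∷ v) ≼ node (pl j) → Found x h v q w φ
      walk-finds x ttᶠ i h v q w at _ j i≤j below =
        ⊥-elim (never-below (cong (node ∘ proj₂) at) (λ h' → next-tt σ τ h' (pl i) (cong (form ∘ proj₂) at)) i≤j below)
      walk-finds x ffᶠ i h v q w at _ j i≤j below =
        ⊥-elim (never-below (cong (node ∘ proj₂) at) (λ h' → next-ff σ τ h' (pl i) (cong (form ∘ proj₂) at)) i≤j below)
      walk-finds x (atom (y , q' , op)) i h v q w at _ = walk-finds-atom x y q' op i h v q w at
      walk-finds x (φ ∨ᶠ ψ) i h v q w at (unφ , unψ) j i≤j below with σ (pos v q w (φ ∨ᶠ ψ) ∷ h) in e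
      ... | true with walk-finds x φ (suc i) _ v q w (run-∨ at e) unφ j (moved-on at i≤j below) below
      ...   | s , walked , at-s , entry-s , dir = s , walked , at-s , entry-s , cong (_∨ hasDir x ψ) dir
      walk-finds x (φ ∨ᶠ ψ) i h v q w at (unφ , unψ) j i≤j below | false
        with walk-finds x ψ (suc i) _ v q w (run-∨ at e) unψ j (moved-on at i≤j below) below
      ...   | s , walked , at-s , entry-s , dir = s , walked , at-s , entry-s , trans (cong (hasDir x φ ∨_) dir) (∨-zeroʳ _)
      walk-finds x (φ ∧ᶠ ψ) i h v q w at (unφ , unψ , excl) j i≤j below with τ (pos v q w (φ ∧ᶠ ψ) ∷ h) in e
      ... | true with walk-finds x φ (suc i) _ v q w (run-∧ at e) unφ j (moved-on at i≤j below) below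
      ...   | s , walked , at-s , entry-s , dir =
              s , trans (cong (walkAt x (pos v q w (φ ∧ᶠ ψ) ∷ h) v q w φ ψ) dir) walked , at-s , entry-s , cong (_∨ hasDir x ψ) dir
      walk-finds x (φ ∧ᶠ ψ) i h v q w at (unφ , unψ , excl) j i≤j below | false
        with walk-finds x ψ (suc i) _ v q w (run-∧ at e) unψ j (moved-on at i≤j below) below
      ...   | s , walked , at-s , entry-s , dir =
              s , trans (cong (walkAt x (pos v q w (φ ∧ᶠ ψ) ∷ h) v q w φ ψ) (at-most-one excl dir)) walked , at-s , entry-s ,
              trans (cong (hasDir x φ ∨_) dir) (∨-zeroʳ _)

      entry-unambiguous : ∀ x e → isEntryAt e ≡ true → Unambiguous x (form (pl e))
      entry-unambiguous x e entry with entry-formula e entry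
      ... | inj₁ eq = subst (Unambiguous x) (sym eq) (unambiguous _ _ _ x)
      ... | inj₂ refl = unambiguous _ _ _ x

      canonical : ∀ xs K → isEntryAt K ≡ true → node (pl K) ≡ xs ++ u → historyAt (xs ++ u) ≡ just (run σ τ p₀ K)
      canonical [] zero _ _ = historyAt-root u refl
      canonical [] (suc K) entry at with entry-descends K entry
      ... | y , eq = ⊥-elim (child-⋠ y (node (pl K)) (subst (_≼ node (pl K)) (trans (sym at) eq) (descends {0} {K} z≤n)))
      canonical (x ∷ xs) zero _ at with ++-identityˡ-unique (x ∷ xs) at
      ... | ()
      canonical (x ∷ xs) (suc K) entry at with entry-descends K entry
      ... | y , eq with ∷-injective (trans (sym eq) at)
      ...   | refl , at-K with lastEntry K
      ...     | e , e≤K , entry-e , node-e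
        with walk-finds x (form (pl e)) e (hist e) (node (pl e)) (state (pl e)) (stack (pl e)) refl
               (entry-unambiguous x e entry-e) (suc K) (m≤n⇒m≤1+n e≤K) ([] , trans eq (cong (x ∷_) (sym node-e)))
      ...       | s , walked , node-s , entry-s , _ = begin
          historyAt (x ∷ xs ++ u)           ≡⟨ historyAt-below x xs ⟩
          walkFrom x (historyAt (xs ++ u))  ≡⟨ cong (walkFrom x) (canonical xs e entry-e (trans node-e at-K)) ⟩
          walkFrom x (just (run σ τ p₀ e))  ≡⟨ walked ⟩
          just (run σ τ p₀ s)               ≡⟨ cong (just ∘ run σ τ p₀) s≡1+K ⟩
          just (run σ τ p₀ (suc K))         ∎
        where
          open ≡-Reasoning
          s≡1+K : s ≡ suc K
          s≡1+K = entry-unique s (suc K) entry-s entry (trans node-s (sym (trans eq (cong (x ∷_) (sym node-e)))))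

module StrategyToLabelling {m d g k : ℕ} (N : CNPTA m d g k) (p : Fin m) (T : Tree m d) (u : Node d) (wι : Stacks g k)
                           (σ⇓ : Game.Strategy (CNPTA.aut (N ⇓ p)) T) where
  open Simulation N p T u wι
  open CAPTA A
  open Descent A⇓ T σ⇓ (λ q a γ x → nondet-unambiguous (CNPTA.nondet (N ⇓ p) q a γ) x)
  open FromRoot u wι

  guessValue : List G⇓.Pos → G⇓.Pos → Bool
  guessValue H P = select (δ₁ (G⇓.node P) (G⇓.state P) (G⇓.stack P)) (δ₀ (G⇓.node P) (G⇓.state P) (G⇓.stack P))
                          (σ⇓ (P ∷ H))

  valueAt : Maybe History → Bool
  valueAt nothing = false
  valueAt (just (H , P)) = guessValue H P

  labelling : Node d → Bool
  labelling v = valueAt (historyAt v)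

  open Labelled labelling

  strategy⇒accept : ((τ⇓ : G⇓.Strategy) → G⇓.EveWinsPlay (G⇓.play σ⇓ τ⇓ (G⇓.initial wι u))) →
    Accepts A wι T⊗f u
  strategy⇒accept win = σ , win-lifted
    where
      σ : G.Strategy
      σ h = σ⇓ (lift h)

      win-lifted : (τ : G.Strategy) → G.EveWinsPlay (G.play σ τ (G.initial wι u))
      win-lifted τ = win⇑ (win τ⇓)
        where
          τ⇓ : G⇓.Strategy
          τ⇓ H = τ (lower H)

          open Coupled σ τ σ⇓ τ⇓ (λ P h → refl) (λ P h → cong τ (lower-lift (P ∷ h)))

          match : GuessesMatch
          match n K at-guess entry = begin
              afterGuess σ⇓ P (lift h)
            ≡⟨ ∨?-select (δ₁ v q w) (δ₀ v q w) (σ⇓ (guessOf P ∷ lift h)) ⟩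
              (if guessValue (lift h) (guessOf P) then δ₁ v q w else δ₀ v q w)
            ≡⟨ cong (λ b → if b then δ₁ v q w else δ₀ v q w) (sym label) ⟩
              (if labelling v then δ₁ v q w else δ₀ v q w)
            ≡⟨ sym (entry-form n entry) ⟩
              G.form P
            ∎
            where
              open ≡-Reasoning
              P : G.Pos
              P = R.pl n
              h : List G.Pos
              h = R.hist n
              v : Node d
              v = G.node P
              q : Fin nQ
              q = G.state P
              w : Stacks g k
              w = G.stack P
              entry⇓ : R⇓.isEntryAt K ≡ true
              entry⇓ = trans (cong₂ P⇓.isEntry (cong proj₂ at-guess) (cong proj₁ at-guess))
                             (trans (entry-lift (guessOf P) P h refl) entry)
              root-path : u ≼ G⇓.node (R⇓.pl K)
              root-path = R⇓.descends {0} {K} z≤n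
              label : labelling v ≡ guessValue (lift h) (guessOf P)
              label = cong valueAt (begin
                  historyAt v
                ≡⟨ cong historyAt (trans (sym (cong (G⇓.node ∘ proj₂) at-guess)) (proj₂ root-path)) ⟩
                  historyAt (proj₁ root-path ++ u)
                ≡⟨ canonical τ⇓ (proj₁ root-path) K entry⇓ (proj₂ root-path) ⟩
                  just (run⇓ K)
                ≡⟨ cong just at-guess ⟩
                  just (lift h , guessOf P)
                ∎)

          open Synchronised match

proposition6p8 : (m d g k : ℕ) → 1 ≤ k → (N : CNPTA m d g k) (p : Fin m) →
    Σ (CNPTA m d g k) λ Np →
      (T : Tree m d) (u : Node d) (wι : Stacks g k) →
        (Accepts (CNPTA.aut Np) wι T u →
          Σ (Node d → Bool) λ f → Accepts (CNPTA.aut N) wι (T ⊗[ p ] f) u)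
        × ((Σ (Node d → Bool) λ f → Accepts (CNPTA.aut N) wι (T ⊗[ p ] f) u) →
          Accepts (CNPTA.aut Np) wι T u)
proposition6p8 m d g k _ N p = N ⇓ p , λ T u wι → guess-labelling T u wι , follow-labelling T u wι
  where
    guess-labelling : ∀ T u wι → Accepts (CNPTA.aut (N ⇓ p)) wι T u →
      Σ (Node d → Bool) λ f → Accepts (CNPTA.aut N) wι (T ⊗[ p ] f) u
    guess-labelling T u wι (σ⇓ , win) = labelling , strategy⇒accept win
      where open StrategyToLabelling N p T u wι σ⇓

    follow-labelling : ∀ T u wι → (Σ (Node d → Bool) λ f → Accepts (CNPTA.aut N) wι (T ⊗[ p ] f) u) →
      Accepts (CNPTA.aut (N ⇓ p)) wι T u
    follow-labelling T u wι (f , accept) = labelling⇒accept accept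
      where open LabellingToStrategy N p T u wι f
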